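{- Let $\mathbf{a} \in \mathsf{RAsc}$ and let $\mathbf{a}^*$ be its dual according to $f_{\mathsf{PA}}$. Then $\mathbf{a}^* = \mathsf{pan}(\mathbf{a})$.
   Context: Ascent sequences: $a_1=0$, $a_i\le\mathsf{asc}(a_1,\ldots,a_{i-1})+1$. $\mathsf{RAsc}$: ascent sequences with $a_k\in[0,a_{k-1}]\cup\{1+\mathsf{asc}(a_1,\ldots,a_{k-1})\}$ for $k>1$. $f_{\mathsf{AP}}$ maps ascent sequences to (2+2)-free posets: with strict downsets $\emptyset=D_0\subsetneq\cdots\subsetneq D_{\ell(P)}$, level $L_i$ = elements with strict downset $D_i$, $\ell^\star(P)$ = minimum index of a level containing a maximal element; start from a one-element poset and for each $a_{k+1}$: if $a_{k+1}\le\ell^\star$, add a new maximal element covering the same elements as the elements of $L_{a_{k+1}}$; if $a_{k+1}=1+\ell$, add a new element covering all maximal elements; if $\ell^\star<a_{k+1}\le\ell$, add a new element covering the same elements as those of $L_{a_{k+1}}$ and add relations $x\prec y$ for every maximal $x$ at level $<a_{k+1}$ and every old $y$ at level $\ge a_{k+1}$. $f_{\mathsf{PA}}=f_{\mathsf{AP}}^{ -1}$, and the dual is $\mathbf{a}^*=f_{\mathsf{PA}}(P^*)$ with $P=f_{\mathsf{AP}}(\mathbf{a})$, $P^*$ the order-reversed poset. For a sequence $(a_1,\ldots,a_k)$ of reals, the view $v_i$ is defined recursively: if $j$ is the minimum index $>i$ with $a_j>a_i$, then $v_i=v_j+1$; if no such $j$ exists, $v_i=0$. The panorama $\mathsf{pan}(\mathbf{a})$: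 list the views of the positions where the maximum value occurs (in left-to-right order), then append the views of positions of the next highest value, and so on until all views are listed. -}

module Defs where

open import Data.Nat using (ℕ; zero; suc; _+_; _≤_; _<ᵇ_; _≡ᵇ_; _⊔_; _⊓_)
open import Data.Bool using (Bool; true; false; _∧_; _∨_; not; if_then_else_)
open import Data.List using (List; []; _∷_; _++_; foldl; concatMap)
open import Data.Fin using (Fin; toℕ)
open import Data.Product using (Σ; _×_)
open import Data.Sum using (_⊎_)
open import Data.Unit using (⊤)
open import Data.Empty using (⊥)
open import Function.Bundles using (_↔_; Inverse)
open import Relation.Binary.PropositionalEquality using (_≡_)

-- AscFrom l c xs : the remaining entries xs are admissible, given that the
-- last entry so far is l and the prefix so far has c ascents.
AscFrom : ℕ → ℕ → List ℕ → Set
AscFrom l c []       = ⊤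
AscFrom l c (x ∷ xs) = (x ≤ suc c) × AscFrom x (if l <ᵇ x then suc c else c) xs

IsAsc : List ℕ → Set
IsAsc []       = ⊥
IsAsc (x ∷ xs) = (x ≡ 0) × AscFrom 0 0 xs

RFrom : ℕ → ℕ → List ℕ → Set
RFrom l c []       = ⊤
RFrom l c (x ∷ xs) = ((x ≤ l) ⊎ (x ≡ suc c)) × RFrom x (if l <ᵇ x then suc c else c) xs

IsRAsc : List ℕ → Set
IsRAsc []       = ⊥
IsRAsc (x ∷ xs) = IsAsc (x ∷ xs) × RFrom x 0 xs

-- Finite posets: elements 0 .. size-1, strict order given by a boolean relation

record Pos : Set where
  field
    size : ℕ
    rel  : ℕ → ℕ → Bool   -- rel x y = true  iff  x ≺ y

open Pos public

allUpTo : ℕ → (ℕ → Bool) → Bool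
allUpTo zero    p = true
allUpTo (suc n) p = allUpTo n p ∧ p n

anyUpTo : ℕ → (ℕ → Bool) → Bool
anyUpTo zero    p = false
anyUpTo (suc n) p = anyUpTo n p ∨ p n

countUpTo : ℕ → (ℕ → Bool) → ℕ
countUpTo zero    p = 0
countUpTo (suc n) p = countUpTo n p + (if p n then 1 else 0)

maxUpTo : ℕ → (ℕ → ℕ) → ℕ
maxUpTo zero    f = 0
maxUpTo (suc n) f = maxUpTo n f ⊔ f n

_⇒ᵇ_ : Bool → Bool → Bool
b ⇒ᵇ c = not b ∨ c

module _ (P : Pos) where
  private
    n = size P
    r = rel P

  subD : ℕ → ℕ → Bool
  subD y x = allUpTo n (λ z → r z y ⇒ᵇ r z x)

  eqD : ℕ → ℕ → Bool
  eqD y x = subD y x ∧ subD x y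

  psubD : ℕ → ℕ → Bool
  psubD y x = subD y x ∧ not (subD x y)

  firstRep : ℕ → Bool
  firstRep y = not (anyUpTo y (λ z → eqD z y))

  -- level of x: the index i with D(x) = D_i, i.e. the number of distinct
  -- strict downsets properly contained in D(x)
  level : ℕ → ℕ
  level x = countUpTo n (λ y → psubD y x ∧ firstRep y)

  isMax : ℕ → Bool
  isMax x = not (anyUpTo n (λ y → r x y))

  ell : ℕ
  ell = maxUpTo n level

  ellStar : ℕ
  ellStar = go n
    where
      go : ℕ → ℕ
      go zero    = ell
      go (suc k) = if isMax k then go k ⊓ level k else go k

  inD : ℕ → ℕ → Bool
  inD i z = anyUpTo n (λ x → (level x ≡ᵇ i) ∧ r z x)

-- one step of f_AP: add the new element (labelled size P) for the entry a
step : Pos → ℕ → Pos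
step P a = record { size = suc n ; rel = r' }
  where
    n = size P
    top : Bool
    top = a ≡ᵇ suc (ell P)
    middle : Bool
    middle = (ellStar P <ᵇ a) ∧ not top
    newDown : ℕ → Bool
    newDown y = if top then true else inD P a y
    extra : ℕ → ℕ → Bool
    extra x y = middle ∧ isMax P x ∧ (level P x <ᵇ a) ∧ not (level P y <ᵇ a)
    r' : ℕ → ℕ → Bool
    r' x y = if y <ᵇ n then ((x <ᵇ n) ∧ (rel P x y ∨ extra x y))
             else if y ≡ᵇ n then ((x <ᵇ n) ∧ newDown x)
             else false

onePoint : Pos
onePoint = record { size = 1 ; rel = λ _ _ → false }

emptyPos : Pos
emptyPos = record { size = 0 ; rel = λ _ _ → false }

-- f_AP (the first entry a_1 = 0 gives the one-element poset)
fAP : List ℕ → Pos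
fAP []       = emptyPos
fAP (_ ∷ as) = foldl step onePoint as

dual : Pos → Pos
dual P = record { size = size P ; rel = λ x y → rel P y x }

_≅_ : Pos → Pos → Set
P ≅ Q = Σ (Fin (size P) ↔ Fin (size Q)) λ e →
          ∀ (x y : Fin (size P)) →
            rel P (toℕ x) (toℕ y) ≡ rel Q (toℕ (Inverse.to e x)) (toℕ (Inverse.to e y))

-- view of an entry with value x, given the entries ys to its right and their views
viewAt : ℕ → List ℕ → List ℕ → ℕ
viewAt x (y ∷ ys) (w ∷ ws) = if x <ᵇ y then suc w else viewAt x ys ws
viewAt x _        _        = 0

views : List ℕ → List ℕ
views []       = []
views (x ∷ xs) = viewAt x xs (views xs) ∷ views xs

viewsWithValue : ℕ → List ℕ → List ℕ → List ℕ
viewsWithValue v (x ∷ xs) (w ∷ ws) =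
  if x ≡ᵇ v then w ∷ viewsWithValue v xs ws else viewsWithValue v xs ws
viewsWithValue v _ _ = []

maxList : List ℕ → ℕ
maxList []       = 0
maxList (x ∷ xs) = x ⊔ maxList xs

downFromIncl : ℕ → List ℕ
downFromIncl zero    = 0 ∷ []
downFromIncl (suc m) = suc m ∷ downFromIncl m

pan : List ℕ → List ℕ
pan a = concatMap (λ v → viewsWithValue v a (views a)) (downFromIncl (maxList a))

{-# OPTIONS --safe #-}

-- Record the k-th entry of a ∈ RAsc as the interval [a_k , asc(a_1 … a_k)]. Consecutive
-- intervals either keep the ascent count with a weakly smaller entry or jump to
-- [1 + asc , 1 + asc], so [v , v] occurs for every v up to the current ascent count. Hence
-- strict downsets, and so levels, are determined by lower ends, and induction along f_AP
-- shows that f_AP(a) is the interval order x ≺ y ⇔ hi x < lo y.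
-- The view of an entry is the number of ascents after it, M − hi with M the final ascent
-- count, so pan(a) reads off the lower ends of the mirrored intervals [M − hi , M − lo],
-- grouped by decreasing entry value. Each group starts with a jump and then only stays, so
-- the mirrored intervals in panorama order are again such a sequence: f_AP(pan a) is their
-- interval order, a relabelling of the mirror image of f_AP(a), which is its dual.

module Submission where

open import Defs
open import Data.Bool using (Bool; true; false; _∧_; _∨_; not; if_then_else_)
open import Data.Bool.Properties using (∧-zeroʳ; ∧-identityʳ; ∨-identityʳ; ∨-zeroʳ; T-≡; not-¬; ¬-not)
open import Data.Empty using (⊥-elim)
open import Data.Fin using (Fin; toℕ)
open import Data.Fin.Properties using (toℕ-cast; toℕ<n)
import Data.Fin.Permutation as Perm
open import Data.List using (List; []; _∷_; _++_; foldl; map; length; drop; concatMap; filter; lookup)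
open import Data.List.Properties using (map-concatMap; concatMap-cong; map-∘; length-map; ++-identityʳ; filter-all; partition-defn)
open import Data.List.Relation.Binary.Permutation.Propositional using (_↭_; ↭-trans; ↭-sym; ↭-reflexive; ↭⇒↭ₛ; ↭ₛ⇒↭; module PermutationReasoning)
open import Data.List.Relation.Binary.Permutation.Propositional.Properties using (++⁺ˡ; map⁺)
import Data.List.Relation.Binary.Permutation.Setoid as SetoidPerm
import Data.List.Relation.Binary.Permutation.Setoid.Properties as SetoidPerm
open import Data.List.Relation.Unary.All as All using (All; []; _∷_)
open import Data.List.Relation.Unary.All.Properties using (all-filter; filter⁺)
open import Data.Nat using (ℕ; zero; suc; _+_; _∸_; _≤_; _<_; _<ᵇ_; _≡ᵇ_; _⊔_; _⊓_; z≤n; s≤s; s≤s⁻¹; _≟_)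
open import Data.Nat.Properties
open import Data.Product using (∃-syntax; _×_; _,_; proj₁; proj₂)
open import Data.Sum using (inj₁; inj₂)
open import Data.Unit using (tt)
open import Function.Bundles using (Equivalence; Inverse)
open import Function.Construct.Identity using (↔-id)
open import Relation.Binary.PropositionalEquality using (_≡_; _≢_; refl; sym; trans; cong; cong₂; subst; setoid; module ≡-Reasoning)
open import Relation.Nullary using (¬_)
open import Relation.Unary.Properties using (∁?)

<ᵇ-true : ∀ {m n} → m < n → (m <ᵇ n) ≡ true
<ᵇ-true m<n = Equivalence.to T-≡ (<⇒<ᵇ m<n)

<ᵇ-true⁻¹ : ∀ {m n} → (m <ᵇ n) ≡ true → m < n
<ᵇ-true⁻¹ {m} {n} m<ᵇn = <ᵇ⇒< m n (Equivalence.from T-≡ m<ᵇn)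

<ᵇ-false : ∀ {m n} → n ≤ m → (m <ᵇ n) ≡ false
<ᵇ-false n≤m = ¬-not (λ m<ᵇn → ≤⇒≯ n≤m (<ᵇ-true⁻¹ m<ᵇn))

<ᵇ-false⁻¹ : ∀ {m n} → (m <ᵇ n) ≡ false → n ≤ m
<ᵇ-false⁻¹ m≮ᵇn = ≮⇒≥ (λ m<n → not-¬ (<ᵇ-true m<n) m≮ᵇn)

≡ᵇ-refl : ∀ n → (n ≡ᵇ n) ≡ true
≡ᵇ-refl n = Equivalence.to T-≡ (≡⇒≡ᵇ n n refl)

≡ᵇ-true⁻¹ : ∀ {m n} → (m ≡ᵇ n) ≡ true → m ≡ n
≡ᵇ-true⁻¹ {m} {n} m≡ᵇn = ≡ᵇ⇒≡ m n (Equivalence.from T-≡ m≡ᵇn)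

≡ᵇ-false : ∀ {m n} → m ≢ n → (m ≡ᵇ n) ≡ false
≡ᵇ-false m≢n = ¬-not (λ m≡ᵇn → m≢n (≡ᵇ-true⁻¹ m≡ᵇn))

≯ᵇ∧<ᵇ : ∀ m n → (not (n <ᵇ m) ∧ not (not (m <ᵇ n))) ≡ (m <ᵇ n)
≯ᵇ∧<ᵇ zero    zero    = refl
≯ᵇ∧<ᵇ zero    (suc n) = refl
≯ᵇ∧<ᵇ (suc m) zero    = refl
≯ᵇ∧<ᵇ (suc m) (suc n) = ≯ᵇ∧<ᵇ m n

≯ᵇ∧≮ᵇ : ∀ m n → (not (n <ᵇ m) ∧ not (m <ᵇ n)) ≡ (m ≡ᵇ n)
≯ᵇ∧≮ᵇ zero    zero    = refl
≯ᵇ∧≮ᵇ zero    (suc n) = refl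
≯ᵇ∧≮ᵇ (suc m) zero    = refl
≯ᵇ∧≮ᵇ (suc m) (suc n) = ≯ᵇ∧≮ᵇ m n

⇒ᵇ-true : ∀ {b c} → (b ≡ true → c ≡ true) → (b ⇒ᵇ c) ≡ true
⇒ᵇ-true {false} _   = refl
⇒ᵇ-true {true}  b⇒c = b⇒c refl

⊓-suc : ∀ m n → m ⊓ n + (if n <ᵇ m then 1 else 0) ≡ m ⊓ suc n
⊓-suc zero    n       = refl
⊓-suc (suc m) zero    = cong suc (sym (⊓-zeroʳ m))
⊓-suc (suc m) (suc n) = cong suc (⊓-suc m n)

m<n⇒n∸m≡1+[n∸1+m] : ∀ {m n} → m < n → n ∸ m ≡ suc (n ∸ suc m)
m<n⇒n∸m≡1+[n∸1+m] {zero}  {suc n} _         = refl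
m<n⇒n∸m≡1+[n∸1+m] {suc m} {suc n} (s≤s m<n) = m<n⇒n∸m≡1+[n∸1+m] m<n

∸-<ᵇ-swap : ∀ {M m n} → m ≤ M → n ≤ M → (M ∸ m <ᵇ M ∸ n) ≡ (n <ᵇ m)
∸-<ᵇ-swap {M} {m} {n} m≤M n≤M with n <ᵇ m in n<ᵇm
... | true  = <ᵇ-true (∸-monoʳ-< (<ᵇ-true⁻¹ {n} {m} n<ᵇm) m≤M)
... | false = <ᵇ-false (∸-monoʳ-≤ M (<ᵇ-false⁻¹ {n} {m} n<ᵇm))

<-suc-elim : ∀ {n} {Q : ℕ → Set} → (∀ x → x < n → Q x) → Q n → ∀ x → x < suc n → Q x
<-suc-elim old new x x<1+n with m<1+n⇒m<n∨m≡n x<1+n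
... | inj₁ x<n  = old x x<n
... | inj₂ refl = new

allUpTo-cong : ∀ n {p q : ℕ → Bool} → (∀ z → z < n → p z ≡ q z) → allUpTo n p ≡ allUpTo n q
allUpTo-cong zero    p≗q = refl
allUpTo-cong (suc n) p≗q = cong₂ _∧_ (allUpTo-cong n (λ z z<n → p≗q z (m<n⇒m<1+n z<n))) (p≗q n ≤-refl)

anyUpTo-cong : ∀ n {p q : ℕ → Bool} → (∀ z → z < n → p z ≡ q z) → anyUpTo n p ≡ anyUpTo n q
anyUpTo-cong zero    p≗q = refl
anyUpTo-cong (suc n) p≗q = cong₂ _∨_ (anyUpTo-cong n (λ z z<n → p≗q z (m<n⇒m<1+n z<n))) (p≗q n ≤-refl)

countUpTo-cong : ∀ n {p q : ℕ → Bool} → (∀ z → z < n → p z ≡ q z) → countUpTo n p ≡ countUpTo n q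
countUpTo-cong zero    p≗q = refl
countUpTo-cong (suc n) p≗q =
  cong₂ _+_ (countUpTo-cong n (λ z z<n → p≗q z (m<n⇒m<1+n z<n)))
            (cong (λ b → if b then 1 else 0) (p≗q n ≤-refl))

maxUpTo-cong : ∀ n {f g : ℕ → ℕ} → (∀ z → z < n → f z ≡ g z) → maxUpTo n f ≡ maxUpTo n g
maxUpTo-cong zero    f≗g = refl
maxUpTo-cong (suc n) f≗g = cong₂ _⊔_ (maxUpTo-cong n (λ z z<n → f≗g z (m<n⇒m<1+n z<n))) (f≗g n ≤-refl)

allUpTo-true : ∀ n {p : ℕ → Bool} → (∀ z → z < n → p z ≡ true) → allUpTo n p ≡ true
allUpTo-true zero    all = refl
allUpTo-true (suc n) all rewrite allUpTo-true n (λ z z<n → all z (m<n⇒m<1+n z<n)) = all n ≤-refl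

allUpTo-false : ∀ n {p : ℕ → Bool} z → z < n → p z ≡ false → allUpTo n p ≡ false
allUpTo-false (suc n) {p} z z<1+n pz with m<1+n⇒m<n∨m≡n z<1+n
... | inj₁ z<n  rewrite allUpTo-false n {p} z z<n pz = refl
... | inj₂ refl rewrite pz = ∧-zeroʳ (allUpTo z p)

anyUpTo-false : ∀ n {p : ℕ → Bool} → (∀ z → z < n → p z ≡ false) → anyUpTo n p ≡ false
anyUpTo-false zero    none = refl
anyUpTo-false (suc n) none rewrite anyUpTo-false n (λ z z<n → none z (m<n⇒m<1+n z<n)) = none n ≤-refl

anyUpTo-true : ∀ n {p : ℕ → Bool} z → z < n → p z ≡ true → anyUpTo n p ≡ true
anyUpTo-true (suc n) {p} z z<1+n pz with m<1+n⇒m<n∨m≡n z<1+n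
... | inj₁ z<n  rewrite anyUpTo-true n {p} z z<n pz = refl
... | inj₂ refl rewrite pz = ∨-zeroʳ (anyUpTo z p)

maxUpTo-lub : ∀ n {f : ℕ → ℕ} {m} → (∀ z → z < n → f z ≤ m) → maxUpTo n f ≤ m
maxUpTo-lub zero    f≤m = z≤n
maxUpTo-lub (suc n) f≤m = ⊔-lub (maxUpTo-lub n (λ z z<n → f≤m z (m<n⇒m<1+n z<n))) (f≤m n ≤-refl)

maxUpTo-upper : ∀ n {f : ℕ → ℕ} z → z < n → f z ≤ maxUpTo n f
maxUpTo-upper (suc n) {f} z z<1+n with m<1+n⇒m<n∨m≡n z<1+n
... | inj₁ z<n  = ≤-trans (maxUpTo-upper n z z<n) (m≤m⊔n (maxUpTo n f) (f n))
... | inj₂ refl = m≤n⊔m (maxUpTo z f) (f z)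

-- Interval orders

record Interval : Set where
  constructor [_,_]
  field
    lo hi : ℕ

open Interval

_≺ᵇ_ : Interval → Interval → Bool
I ≺ᵇ J = hi I <ᵇ lo J

_!_ : List Interval → ℕ → Interval
[]       ! _     = [ 0 , 0 ]
(I ∷ Is) ! zero  = I
(I ∷ Is) ! suc k = Is ! k

intervalOrder : List Interval → Pos
intervalOrder L = record { size = length L ; rel = λ x y → (L ! x) ≺ᵇ (L ! y) }

mirror : ℕ → Interval → Interval
mirror M I = [ M ∸ hi I , M ∸ lo I ]

Within : ℕ → Interval → Set
Within M I = lo I ≤ hi I × hi I ≤ M

Within⇒lo≤ : ∀ {M I} → Within M I → lo I ≤ M
Within⇒lo≤ (lo≤hi , hi≤M) = ≤-trans lo≤hi hi≤M

_≐_ : Pos → Pos → Set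
P ≐ Q = size P ≡ size Q × (∀ x y → x < size P → y < size P → rel P x y ≡ rel Q x y)

≐-sym : ∀ {P Q} → P ≐ Q → Q ≐ P
≐-sym (P≡Q , rel≡) = sym P≡Q , λ x y x<Q y<Q →
  sym (rel≡ x y (subst (x <_) (sym P≡Q) x<Q) (subst (y <_) (sym P≡Q) y<Q))

dual-cong : ∀ {P Q} → P ≐ Q → dual P ≐ dual Q
dual-cong (P≡Q , rel≡) = P≡Q , λ x y x<P y<P → rel≡ y x y<P x<P

≐⇒≅ : ∀ {P Q} → P ≐ Q → P ≅ Q
≐⇒≅ {P} {Q} (P≡Q , rel≡) = Perm.cast-id P≡Q , λ x y →
  trans (rel≡ (toℕ x) (toℕ y) (toℕ<n x) (toℕ<n y))
        (sym (cong₂ (rel Q) (toℕ-cast P≡Q x) (toℕ-cast P≡Q y)))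

≅-trans : ∀ {P Q R} → P ≅ Q → Q ≅ R → P ≅ R
≅-trans (e , rel≡) (f , rel≡′) = e Perm.∘ₚ f , λ x y → trans (rel≡ x y) (rel≡′ _ _)

module ≅-Reasoning where
  infix  1 begin_
  infixr 2 _≅⟨_⟩_ _≐⟨_⟩_
  infix  3 _∎

  -- P ≅ Q unfolds to a Σ-type from which P and Q cannot be inferred; this wrapper keeps them.
  record _IsoTo_ (P Q : Pos) : Set where
    constructor relTo
    field iso : P ≅ Q

  begin_ : ∀ {P Q} → P IsoTo Q → P ≅ Q
  begin relTo P≅Q = P≅Q

  _≅⟨_⟩_ : ∀ P {Q R} → P ≅ Q → Q IsoTo R → P IsoTo R
  _≅⟨_⟩_ P {Q} {R} P≅Q (relTo Q≅R) = relTo (≅-trans {P} {Q} {R} P≅Q Q≅R)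

  _≐⟨_⟩_ : ∀ P {Q R} → P ≐ Q → Q IsoTo R → P IsoTo R
  P ≐⟨ P≐Q ⟩ Q≅R = P ≅⟨ ≐⇒≅ P≐Q ⟩ Q≅R

  _∎ : ∀ P → P IsoTo P
  P ∎ = relTo (↔-id (Fin (size P)) , λ x y → refl)

!-lookup : ∀ L (i : Fin (length L)) → L ! toℕ i ≡ lookup L i
!-lookup (I ∷ L) Fin.zero    = refl
!-lookup (I ∷ L) (Fin.suc i) = !-lookup L i

!-map : ∀ f L {i} → i < length L → map f L ! i ≡ f (L ! i)
!-map f (I ∷ L) {zero}  _         = refl
!-map f (I ∷ L) {suc i} (s≤s i<n) = !-map f L i<n

!-All : ∀ {P : Interval → Set} {L i} → All P L → i < length L → P (L ! i)
!-All {i = zero}  (p ∷ _)  _         = p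
!-All {i = suc i} (_ ∷ ps) (s≤s i<n) = !-All ps i<n

↭⇒≅ : ∀ {L L′} → L ↭ L′ → intervalOrder L ≅ intervalOrder L′
↭⇒≅ {L} {L′} L↭L′ = SetoidPerm.onIndices σ , λ x y → cong₂ _≺ᵇ_ (same x) (same y)
  where
    σ = ↭⇒↭ₛ L↭L′
    same : ∀ i → L ! toℕ i ≡ L′ ! toℕ (Inverse.to (SetoidPerm.onIndices σ) i)
    same i = trans (!-lookup L i)
             (trans (SetoidPerm.onIndices-lookup (setoid Interval) σ i) (sym (!-lookup L′ _)))

intervalOrder-mirror : ∀ {M L} → All (Within M) L → intervalOrder (map (mirror M) L) ≐ dual (intervalOrder L)
intervalOrder-mirror {M} {L} within = length-map (mirror M) L , λ x y x<n y<n →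
  let x<L = subst (x <_) (length-map (mirror M) L) x<n
      y<L = subst (y <_) (length-map (mirror M) L) y<n
  in trans (cong₂ _≺ᵇ_ (!-map (mirror M) L x<L) (!-map (mirror M) L y<L))
           (∸-<ᵇ-swap (Within⇒lo≤ (!-All within x<L)) (proj₂ (!-All within y<L)))

-- Walks

-- Consecutive intervals [a_k , asc(a_1 … a_k)] of a restricted ascent sequence.
data _⇾_ : Interval → Interval → Set where
  stay : ∀ {v v′ r} → v′ ≤ v → [ v , r ] ⇾ [ v′ , r ]
  jump : ∀ {v r} → [ v , r ] ⇾ [ suc r , suc r ]

data Walk : Interval → List Interval → Set where
  []  : ∀ {I} → Walk I []
  _∷_ : ∀ {I J Js} → I ⇾ J → Walk J Js → Walk I (J ∷ Js)

data RWalk : List Interval → Set where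
  start : ∀ {Is} → Walk [ 0 , 0 ] Is → RWalk ([ 0 , 0 ] ∷ Is)

⇾-hi : ∀ {I J} → I ⇾ J → hi I ≤ hi J
⇾-hi (stay _) = ≤-refl
⇾-hi jump     = n≤1+n _

⇾-Within : ∀ {I J} → I ⇾ J → lo I ≤ hi I → lo J ≤ hi J
⇾-Within (stay v′≤v) v≤r = ≤-trans v′≤v v≤r
⇾-Within jump        _   = ≤-refl

finalHi : Interval → List Interval → ℕ
finalHi I []       = hi I
finalHi I (J ∷ Js) = finalHi J Js

hi≤finalHi : ∀ {I Js} → Walk I Js → hi I ≤ finalHi I Js
hi≤finalHi []           = ≤-refl
hi≤finalHi (I⇾J ∷ walk) = ≤-trans (⇾-hi I⇾J) (hi≤finalHi walk)

walk-Within : ∀ {I Js} → Walk I Js → lo I ≤ hi I → All (Within (finalHi I Js)) Js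
walk-Within []           _     = []
walk-Within (I⇾J ∷ walk) lo≤hi = (J-lo≤hi , hi≤finalHi walk) ∷ walk-Within walk J-lo≤hi
  where J-lo≤hi = ⇾-Within I⇾J lo≤hi

walk-asc : ∀ {I Js} → Walk I Js → lo I ≤ hi I → AscFrom (lo I) (hi I) (map lo Js)
walk-asc []                 _   = tt
walk-asc (stay v′≤v ∷ walk) v≤r rewrite <ᵇ-false v′≤v =
  m≤n⇒m≤1+n (≤-trans v′≤v v≤r) , walk-asc walk (≤-trans v′≤v v≤r)
walk-asc (jump ∷ walk)      v≤r rewrite <ᵇ-true (s≤s v≤r) = ≤-refl , walk-asc walk ≤-refl

rwalk-asc : ∀ {L} → RWalk L → IsAsc (map lo L)
rwalk-asc (start walk) = refl , walk-asc walk z≤n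

-- The first later entry exceeding x is the next jump, so a view counts the ascents to come.
viewAt-walk : ∀ {I Js x} → Walk I Js → lo I ≤ x → x ≤ hi I →
              viewAt x (map lo Js) (views (map lo Js)) ≡ finalHi I Js ∸ hi I
viewAt-walk {I} [] _ _ = sym (n∸n≡0 (hi I))
viewAt-walk (stay v′≤v ∷ walk) v≤x x≤r rewrite <ᵇ-false (≤-trans v′≤v v≤x) =
  viewAt-walk walk (≤-trans v′≤v v≤x) x≤r
viewAt-walk (jump ∷ walk)      v≤x x≤r rewrite <ᵇ-true (s≤s x≤r) =
  trans (cong suc (viewAt-walk walk ≤-refl ≤-refl)) (sym (m<n⇒n∸m≡1+[n∸1+m] (hi≤finalHi walk)))

views-walk : ∀ {I Js} → Walk I Js → lo I ≤ hi I → views (map lo Js) ≡ map (λ J → finalHi I Js ∸ hi J) Js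
views-walk []           _     = refl
views-walk (I⇾J ∷ walk) lo≤hi =
  cong₂ _∷_ (viewAt-walk walk ≤-refl J-lo≤hi) (views-walk walk J-lo≤hi)
  where J-lo≤hi = ⇾-Within I⇾J lo≤hi

maxList-walk : ∀ {I Js} → Walk I Js → lo I ≤ hi I → maxList (map lo Js) ⊔ hi I ≡ finalHi I Js
maxList-walk [] _ = refl
maxList-walk {[ v , r ]} {[ v′ , r ] ∷ Js} (stay v′≤v ∷ walk) v≤r = begin
    (v′ ⊔ maxList (map lo Js)) ⊔ r ≡⟨ ⊔-assoc v′ _ r ⟩
    v′ ⊔ (maxList (map lo Js) ⊔ r) ≡⟨ cong (v′ ⊔_) (maxList-walk walk v′≤r) ⟩
    v′ ⊔ finalHi [ v′ , r ] Js     ≡⟨ m≤n⇒m⊔n≡n (≤-trans v′≤r (hi≤finalHi walk)) ⟩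
    finalHi [ v′ , r ] Js          ∎
  where
    open ≡-Reasoning
    v′≤r = ≤-trans v′≤v v≤r
maxList-walk {[ v , r ]} {_ ∷ Js} (jump ∷ walk) _ = begin
    (suc r ⊔ maxList (map lo Js)) ⊔ r ≡⟨ cong (_⊔ r) (⊔-comm (suc r) _) ⟩
    (maxList (map lo Js) ⊔ suc r) ⊔ r ≡⟨ ⊔-assoc _ (suc r) r ⟩
    maxList (map lo Js) ⊔ (suc r ⊔ r) ≡⟨ cong (maxList (map lo Js) ⊔_) (m≥n⇒m⊔n≡m (n≤1+n r)) ⟩
    maxList (map lo Js) ⊔ suc r       ≡⟨ maxList-walk walk ≤-refl ⟩
    finalHi [ suc r , suc r ] Js      ∎
  where open ≡-Reasoning

ascAfter : ℕ → ℕ → ℕ → ℕ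
ascAfter l c x = if l <ᵇ x then suc c else c

encode : ℕ → ℕ → List ℕ → List Interval
encode l c []       = []
encode l c (x ∷ xs) = [ x , ascAfter l c x ] ∷ encode x (ascAfter l c x) xs

map-lo-encode : ∀ l c xs → map lo (encode l c xs) ≡ xs
map-lo-encode l c []       = refl
map-lo-encode l c (x ∷ xs) = cong (x ∷_) (map-lo-encode x (ascAfter l c x) xs)

encode-walk : ∀ {l c xs} → RFrom l c xs → l ≤ c → Walk [ l , c ] (encode l c xs)
encode-walk {xs = []}     _                  _   = []
encode-walk {xs = x ∷ xs} (inj₁ x≤l  , rest) l≤c rewrite <ᵇ-false x≤l =
  stay x≤l ∷ encode-walk rest (≤-trans x≤l l≤c)
encode-walk {xs = x ∷ xs} (inj₂ refl , rest) l≤c rewrite <ᵇ-true (s≤s l≤c) =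
  jump ∷ encode-walk rest ≤-refl

rasc-walk : ∀ {a} → IsRAsc a → ∃[ L ] RWalk L × map lo L ≡ a
rasc-walk {0 ∷ xs} ((refl , _) , rest) =
  [ 0 , 0 ] ∷ encode 0 0 xs , start (encode-walk rest z≤n) , cong (0 ∷_) (map-lo-encode 0 0 xs)

-- The poset of a walk

extra : Pos → ℕ → ℕ → ℕ → Bool
extra P a x y = isMax P x ∧ ((level P x <ᵇ a) ∧ not (level P y <ᵇ a))

newDown : Pos → ℕ → ℕ → Bool
newDown P a x = if a ≡ᵇ suc (ell P) then true else inD P a x

module _ (P : Pos) (a : ℕ) where
  private
    n = size P

  step-old : ∀ {x y} → x < n → y < n → extra P a x y ≡ false → rel (step P a) x y ≡ rel P x y
  step-old {x} {y} x<n y<n noExtra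
    rewrite <ᵇ-true y<n | <ᵇ-true x<n | noExtra
          | ∧-zeroʳ ((ellStar P <ᵇ a) ∧ not (a ≡ᵇ suc (ell P))) = ∨-identityʳ (rel P x y)

  step-new-below : ∀ {y} → y < n → rel (step P a) n y ≡ false
  step-new-below y<n rewrite <ᵇ-true y<n | <ᵇ-false (≤-refl {n}) = refl

  step-new-above : ∀ {x} → x < n → rel (step P a) x n ≡ newDown P a x
  step-new-above x<n rewrite <ᵇ-false (≤-refl {n}) | ≡ᵇ-refl n | <ᵇ-true x<n = refl

  step-new-irrefl : rel (step P a) n n ≡ false
  step-new-irrefl rewrite <ᵇ-false (≤-refl {n}) | ≡ᵇ-refl n = refl

drop-! : ∀ n L {J Js} → drop n L ≡ J ∷ Js → L ! n ≡ J × drop (suc n) L ≡ Js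
drop-! zero    (I ∷ L) refl = refl , refl
drop-! (suc n) (I ∷ L) eq   = drop-! n L eq

size-foldl-step : ∀ P as → size (foldl step P as) ≡ size P + length as
size-foldl-step P []       = sym (+-identityʳ (size P))
size-foldl-step P (a ∷ as) = trans (size-foldl-step (step P a) as) (sym (+-suc (size P) (length as)))

module WalkPoset (L : List Interval) where

  loAt hiAt : ℕ → ℕ
  loAt x = lo (L ! x)
  hiAt x = hi (L ! x)

  firstOcc : ℕ → Bool
  firstOcc y = not (anyUpTo y (λ z → loAt z ≡ᵇ loAt y))

  -- I is the last interval read. The unit intervals [v , v], v ≤ hi I, make the strict downset
  -- {z | hi z < lo x} of x, and with it the level of x, a function of lo x.
  record Invariant (P : Pos) (I : Interval) : Set where
    field
      rel≡≺      : ∀ x y → x < size P → y < size P → rel P x y ≡ (hiAt x <ᵇ loAt y)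
      lo≤hi      : ∀ x → x < size P → loAt x ≤ hiAt x
      hi≤top     : ∀ x → x < size P → hiAt x ≤ hi I
      unit       : ∀ v → v ≤ hi I → ∃[ z ] z < size P × L ! z ≡ [ v , v ]
      lo≤atTop   : ∀ x → x < size P → hiAt x ≡ hi I → lo I ≤ loAt x
      lo≤hi-last : lo I ≤ hi I
      countLo    : ∀ v → countUpTo (size P) (λ y → (loAt y <ᵇ v) ∧ firstOcc y) ≡ v ⊓ suc (hi I)

  module InvariantFacts {P : Pos} {I : Interval} (inv : Invariant P I) where
    open Invariant inv
    private
      n   = size P
      top = hi I

    lo≤top : ∀ x → x < n → loAt x ≤ top
    lo≤top x x<n = ≤-trans (lo≤hi x x<n) (hi≤top x x<n)

    downsets-⊆ : ∀ u v → v ≤ top →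
                 allUpTo n (λ z → (hiAt z <ᵇ u) ⇒ᵇ (hiAt z <ᵇ v)) ≡ not (v <ᵇ u)
    downsets-⊆ u v v≤top with v <ᵇ u in v<u
    ... | true with unit v v≤top
    ...   | z , z<n , Lz = allUpTo-false n z z<n
            (subst (λ h → ((h <ᵇ u) ⇒ᵇ (h <ᵇ v)) ≡ false) (sym (cong hi Lz))
                   (cong₂ _⇒ᵇ_ v<u (<ᵇ-false (≤-refl {v}))))
    downsets-⊆ u v v≤top | false = allUpTo-true n λ z _ →
      ⇒ᵇ-true (λ hz<u → <ᵇ-true (<-≤-trans (<ᵇ-true⁻¹ hz<u) (<ᵇ-false⁻¹ {v} {u} v<u)))

    subD≡ : ∀ y x → y < n → x < n → subD P y x ≡ not (loAt x <ᵇ loAt y)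
    subD≡ y x y<n x<n =
      trans (allUpTo-cong n (λ z z<n → cong₂ _⇒ᵇ_ (rel≡≺ z y z<n y<n) (rel≡≺ z x z<n x<n)))
            (downsets-⊆ (loAt y) (loAt x) (lo≤top x x<n))

    psubD≡ : ∀ y x → y < n → x < n → psubD P y x ≡ (loAt y <ᵇ loAt x)
    psubD≡ y x y<n x<n =
      trans (cong₂ (λ b c → b ∧ not c) (subD≡ y x y<n x<n) (subD≡ x y x<n y<n))
            (≯ᵇ∧<ᵇ (loAt y) (loAt x))

    eqD≡ : ∀ z y → z < n → y < n → eqD P z y ≡ (loAt z ≡ᵇ loAt y)
    eqD≡ z y z<n y<n =
      trans (cong₂ _∧_ (subD≡ z y z<n y<n) (subD≡ y z y<n z<n)) (≯ᵇ∧≮ᵇ (loAt z) (loAt y))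

    firstRep≡ : ∀ y → y < n → firstRep P y ≡ firstOcc y
    firstRep≡ y y<n = cong not (anyUpTo-cong y (λ z z<y → eqD≡ z y (<-trans z<y y<n) y<n))

    level≡ : ∀ x → x < n → level P x ≡ loAt x
    level≡ x x<n = begin
      level P x
        ≡⟨ countUpTo-cong n (λ y y<n → cong₂ _∧_ (psubD≡ y x y<n x<n) (firstRep≡ y y<n)) ⟩
      countUpTo n (λ y → (loAt y <ᵇ loAt x) ∧ firstOcc y)
        ≡⟨ countLo (loAt x) ⟩
      loAt x ⊓ suc top
        ≡⟨ m≤n⇒m⊓n≡m (m≤n⇒m≤1+n (lo≤top x x<n)) ⟩
      loAt x ∎
      where open ≡-Reasoning

    ell≡ : ell P ≡ top
    ell≡ with unit top ≤-refl
    ... | z , z<n , Lz = trans (maxUpTo-cong n level≡)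
      (≤-antisym (maxUpTo-lub n lo≤top) (subst (_≤ maxUpTo n loAt) (cong lo Lz) (maxUpTo-upper n z z<n)))

    isMax⇒hi≡top : ∀ x → x < n → isMax P x ≡ true → hiAt x ≡ top
    isMax⇒hi≡top x x<n max = ≤-antisym (hi≤top x x<n) (≮⇒≥ hx≮top)
      where
        hx≮top : ¬ hiAt x < top
        hx≮top hx<top with unit top ≤-refl
        ... | z , z<n , Lz = not-¬ max (cong not (anyUpTo-true n z z<n
                (trans (rel≡≺ x z x<n z<n) (<ᵇ-true (subst (hiAt x <_) (sym (cong lo Lz)) hx<top)))))

    noExtra : ∀ a x y → x < n → a ≤ lo I → extra P a x y ≡ false
    noExtra a x y x<n a≤lo with isMax P x in max
    ... | false = refl
    ... | true rewrite level≡ x x<n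
                     | <ᵇ-false (≤-trans a≤lo (lo≤atTop x x<n (isMax⇒hi≡top x x<n max))) = refl

    atLevel-above : ∀ a h → a ≤ top → anyUpTo n (λ w → (loAt w ≡ᵇ a) ∧ (h <ᵇ loAt w)) ≡ (h <ᵇ a)
    atLevel-above a h a≤top with h <ᵇ a in h<a
    ... | true with unit a a≤top
    ...   | z , z<n , Lz = anyUpTo-true n z z<n
            (subst (λ l → ((l ≡ᵇ a) ∧ (h <ᵇ l)) ≡ true) (sym (cong lo Lz))
                   (cong₂ _∧_ (≡ᵇ-refl a) h<a))
    atLevel-above a h a≤top | false = anyUpTo-false n (λ w _ → notAbove w)
      where
        notAbove : ∀ w → ((loAt w ≡ᵇ a) ∧ (h <ᵇ loAt w)) ≡ false
        notAbove w with loAt w ≡ᵇ a in w≡a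
        ... | false = refl
        ... | true  = trans (cong (h <ᵇ_) (≡ᵇ-true⁻¹ {loAt w} w≡a)) h<a

    inD≡ : ∀ a x → x < n → a ≤ top → inD P a x ≡ (hiAt x <ᵇ a)
    inD≡ a x x<n a≤top =
      trans (anyUpTo-cong n (λ w w<n → cong₂ _∧_ (cong (_≡ᵇ a) (level≡ w w<n)) (rel≡≺ x w x<n w<n)))
            (atLevel-above a (hiAt x) a≤top)

    firstOcc-repeated : loAt n ≤ top → firstOcc n ≡ false
    firstOcc-repeated new≤top with unit (loAt n) new≤top
    ... | z , z<n , Lz = cong not (anyUpTo-true n z z<n
            (trans (cong (_≡ᵇ loAt n) (cong lo Lz)) (≡ᵇ-refl (loAt n))))

    firstOcc-fresh : top < loAt n → firstOcc n ≡ true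
    firstOcc-fresh top<new = cong not (anyUpTo-false n (λ z z<n →
      ≡ᵇ-false (λ z≡new → <⇒≱ top<new (subst (_≤ top) z≡new (lo≤top z z<n)))))

    step-rel≡≺ : ∀ {J} → L ! n ≡ J → top ≤ hi J → lo J ≤ hi J →
                 (∀ x y → x < n → y < n → extra P (lo J) x y ≡ false) →
                 (∀ x → x < n → newDown P (lo J) x ≡ (hiAt x <ᵇ lo J)) →
                 ∀ x y → x < suc n → y < suc n → rel (step P (lo J)) x y ≡ (hiAt x <ᵇ loAt y)
    step-rel≡≺ {J} next top≤hi lo≤hi′ noExtra′ column x y x<1+n y<1+n
      with m<1+n⇒m<n∨m≡n x<1+n | m<1+n⇒m<n∨m≡n y<1+n
    ... | inj₁ x<n  | inj₁ y<n  = trans (step-old P (lo J) x<n y<n (noExtra′ x y x<n y<n)) (rel≡≺ x y x<n y<n)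
    ... | inj₂ refl | inj₁ y<n  = trans (step-new-below P (lo J) y<n)
      (sym (<ᵇ-false (subst (λ K → loAt y ≤ hi K) (sym next) (≤-trans (lo≤top y y<n) top≤hi))))
    ... | inj₁ x<n  | inj₂ refl = trans (step-new-above P (lo J) x<n)
      (trans (column x x<n) (cong (hiAt x <ᵇ_) (cong lo (sym next))))
    ... | inj₂ refl | inj₂ refl = trans (step-new-irrefl P (lo J))
      (sym (<ᵇ-false (subst (λ K → lo K ≤ hi K) (sym next) lo≤hi′)))

  open InvariantFacts

  stay-invariant : ∀ {P w v r} → Invariant P [ w , r ] → L ! size P ≡ [ v , r ] → v ≤ w →
                   Invariant (step P v) [ v , r ]
  stay-invariant {P} {w} {v} {r} inv next v≤w = record
    { rel≡≺      = step-rel≡≺ inv next ≤-refl v≤r (λ x y x<n _ → noExtra inv v x y x<n v≤w) column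
    ; lo≤hi      = <-suc-elim lo≤hi (subst (λ K → lo K ≤ hi K) (sym next) v≤r)
    ; hi≤top     = <-suc-elim hi≤top (subst (λ K → hi K ≤ r) (sym next) ≤-refl)
    ; unit       = λ u u≤r → let (z , z<n , Lz) = unit u u≤r in z , m<n⇒m<1+n z<n , Lz
    ; lo≤atTop   = <-suc-elim (λ x x<n hx≡r → ≤-trans v≤w (lo≤atTop x x<n hx≡r))
                              (λ _ → subst (λ K → v ≤ lo K) (sym next) ≤-refl)
    ; lo≤hi-last = v≤r
    ; countLo    = count
    }
    where
      open Invariant inv
      v≤r = ≤-trans v≤w lo≤hi-last
      column : ∀ x → x < size P → newDown P v x ≡ (hiAt x <ᵇ v)
      column x x<n rewrite ell≡ inv | ≡ᵇ-false (λ v≡1+r → 1+n≰n (subst (_≤ r) v≡1+r v≤r)) =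
        inD≡ inv v x x<n v≤r
      count : ∀ u → countUpTo (suc (size P)) (λ y → (loAt y <ᵇ u) ∧ firstOcc y) ≡ u ⊓ suc r
      count u rewrite firstOcc-repeated inv (subst (λ K → lo K ≤ r) (sym next) v≤r)
                    | ∧-zeroʳ (loAt (size P) <ᵇ u) | countLo u = +-identityʳ _

  jump-invariant : ∀ {P w r} → Invariant P [ w , r ] → L ! size P ≡ [ suc r , suc r ] →
                   Invariant (step P (suc r)) [ suc r , suc r ]
  jump-invariant {P} {w} {r} inv next = record
    { rel≡≺      = step-rel≡≺ inv next (n≤1+n r) ≤-refl noExtra-jump column
    ; lo≤hi      = <-suc-elim lo≤hi (subst (λ K → lo K ≤ hi K) (sym next) ≤-refl)
    ; hi≤top     = <-suc-elim (λ x x<n → m≤n⇒m≤1+n (hi≤top x x<n))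
                              (subst (λ K → hi K ≤ suc r) (sym next) ≤-refl)
    ; unit       = unit′
    ; lo≤atTop   = <-suc-elim (λ x x<n hx≡1+r → ⊥-elim (1+n≰n (subst (_≤ r) hx≡1+r (hi≤top x x<n))))
                              (λ _ → subst (λ K → suc r ≤ lo K) (sym next) ≤-refl)
    ; lo≤hi-last = ≤-refl
    ; countLo    = count
    }
    where
      open Invariant inv
      noExtra-jump : ∀ x y → x < size P → y < size P → extra P (suc r) x y ≡ false
      noExtra-jump x y _ y<n rewrite level≡ inv y y<n | <ᵇ-true (s≤s (lo≤top inv y y<n))
                               | ∧-zeroʳ (level P x <ᵇ suc r) = ∧-zeroʳ (isMax P x)
      column : ∀ x → x < size P → newDown P (suc r) x ≡ (hiAt x <ᵇ suc r)
      column x x<n rewrite ell≡ inv | ≡ᵇ-refl r = sym (<ᵇ-true (s≤s (hi≤top x x<n)))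
      unit′ : ∀ u → u ≤ suc r → ∃[ z ] z < suc (size P) × L ! z ≡ [ u , u ]
      unit′ u u≤1+r with m≤n⇒m<n∨m≡n u≤1+r
      ... | inj₁ (s≤s u≤r) = let (z , z<n , Lz) = unit u u≤r in z , m<n⇒m<1+n z<n , Lz
      ... | inj₂ refl      = size P , ≤-refl , next
      count : ∀ u → countUpTo (suc (size P)) (λ y → (loAt y <ᵇ u) ∧ firstOcc y) ≡ u ⊓ suc (suc r)
      count u rewrite firstOcc-fresh inv (subst (λ K → r < lo K) (sym next) ≤-refl) | cong lo next
                    | ∧-identityʳ (suc r <ᵇ u) | countLo u = ⊓-suc u (suc r)

  step-invariant : ∀ {P I J} → Invariant P I → L ! size P ≡ J → I ⇾ J → Invariant (step P (lo J)) J
  step-invariant inv next (stay v′≤v) = stay-invariant inv next v′≤v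
  step-invariant inv next jump        = jump-invariant inv next

  walk-invariant : ∀ {P I Js} → Invariant P I → drop (size P) L ≡ Js → Walk I Js →
                   ∃[ K ] Invariant (foldl step P (map lo Js)) K
  walk-invariant inv _ [] = _ , inv
  walk-invariant {P} inv rest (I⇾J ∷ walk) with drop-! (size P) L rest
  ... | next , rest′ = walk-invariant (step-invariant inv next I⇾J) rest′ walk

initial-invariant : ∀ Is → WalkPoset.Invariant ([ 0 , 0 ] ∷ Is) onePoint [ 0 , 0 ]
initial-invariant Is = record
  { rel≡≺      = λ { _ _ (s≤s z≤n) (s≤s z≤n) → refl }
  ; lo≤hi      = λ { _ (s≤s z≤n) → z≤n }
  ; hi≤top     = λ { _ (s≤s z≤n) → z≤n }
  ; unit       = λ { _ z≤n → 0 , s≤s z≤n , refl }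
  ; lo≤atTop   = λ _ _ _ → z≤n
  ; lo≤hi-last = z≤n
  ; countLo    = λ { zero → refl ; (suc v) → cong suc (sym (⊓-zeroʳ v)) }
  }

fAP-walk : ∀ {L} → RWalk L → fAP (map lo L) ≐ intervalOrder L
fAP-walk (start {Is} walk) with WalkPoset.walk-invariant ([ 0 , 0 ] ∷ Is) (initial-invariant Is) refl walk
... | _ , inv = trans (size-foldl-step onePoint (map lo Is)) (cong suc (length-map lo Is)) ,
                WalkPoset.Invariant.rel≡≺ inv

-- The panorama of a walk

withLo : ℕ → List Interval → List Interval
withLo v = filter (λ J → lo J ≟ v)

withoutLo : ℕ → List Interval → List Interval
withoutLo v = filter (∁? (λ J → lo J ≟ v))

viewsWithValue-map : ∀ v Js (g : Interval → ℕ) → viewsWithValue v (map lo Js) (map g Js) ≡ map g (withLo v Js)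
viewsWithValue-map v []       g = refl
viewsWithValue-map v (J ∷ Js) g with lo J ≡ᵇ v
... | true  = cong (g J ∷_) (viewsWithValue-map v Js g)
... | false = viewsWithValue-map v Js g

withLo-withoutLo : ∀ {u v} → v ≢ u → ∀ Js → withLo v (withoutLo u Js) ≡ withLo v Js
withLo-withoutLo v≢u [] = refl
withLo-withoutLo {u} {v} v≢u (J ∷ Js) with lo J ≡ᵇ u in J≡u
... | true rewrite ≡ᵇ-false {lo J} {v} (λ J≡v → v≢u (trans (sym J≡v) (≡ᵇ-true⁻¹ {lo J} J≡u))) =
  withLo-withoutLo v≢u Js
... | false with lo J ≡ᵇ v
...   | true  = cong (J ∷_) (withLo-withoutLo v≢u Js)
...   | false = withLo-withoutLo v≢u Js

withLo-↭ : ∀ u Js → Js ↭ withLo u Js ++ withoutLo u Js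
withLo-↭ u Js = subst (λ parts → Js ↭ proj₁ parts ++ proj₂ parts) (partition-defn (λ J → lo J ≟ u) Js)
                      (↭ₛ⇒↭ (SetoidPerm.partition-↭ (setoid Interval) (λ J → lo J ≟ u) Js))

groups-withoutLo : ∀ {u} m → m < u → ∀ Js →
  concatMap (λ v → withLo v (withoutLo u Js)) (downFromIncl m) ≡ concatMap (λ v → withLo v Js) (downFromIncl m)
groups-withoutLo zero    0<u Js = cong (_++ []) (withLo-withoutLo (<⇒≢ 0<u) Js)
groups-withoutLo (suc m) m<u Js =
  cong₂ _++_ (withLo-withoutLo (<⇒≢ m<u) Js) (groups-withoutLo m (<-trans (n<1+n m) m<u) Js)

groups-↭ : ∀ m Js → All (λ J → lo J ≤ m) Js → concatMap (λ v → withLo v Js) (downFromIncl m) ↭ Js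
groups-↭ zero Js lo≤0 =
  ↭-reflexive (trans (++-identityʳ _) (filter-all (λ J → lo J ≟ 0) (All.map n≤0⇒n≡0 lo≤0)))
groups-↭ (suc m) Js lo≤1+m = begin
  withLo (suc m) Js ++ concatMap (λ v → withLo v Js) (downFromIncl m)
    ≡⟨ cong (withLo (suc m) Js ++_) (sym (groups-withoutLo m (n<1+n m) Js)) ⟩
  withLo (suc m) Js ++ concatMap (λ v → withLo v (withoutLo (suc m) Js)) (downFromIncl m)
    ↭⟨ ++⁺ˡ (withLo (suc m) Js) (groups-↭ m (withoutLo (suc m) Js) lo≤m) ⟩
  withLo (suc m) Js ++ withoutLo (suc m) Js
    ↭⟨ ↭-sym (withLo-↭ (suc m) Js) ⟩
  Js ∎
  where
    open PermutationReasoning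
    lo≤m : All (λ J → lo J ≤ m) (withoutLo (suc m) Js)
    lo≤m = All.map (λ (J≤1+m , J≢1+m) → s≤s⁻¹ (≤∧≢⇒< J≤1+m J≢1+m))
                   (All.zip (filter⁺ _ lo≤1+m , all-filter (∁? (λ J → lo J ≟ suc m)) Js))

data Stays (k : ℕ) : ℕ → List Interval → Set where
  []  : ∀ {w} → Stays k w []
  _∷_ : ∀ {w v G} → v ≤ w → Stays k v G → Stays k w ([ v , k ] ∷ G)

stays-weaken : ∀ {k w w′ G} → w ≤ w′ → Stays k w G → Stays k w′ G
stays-weaken w≤w′ []           = []
stays-weaken w≤w′ (v≤w ∷ rest) = ≤-trans v≤w w≤w′ ∷ rest

Follows : ℕ → List Interval → Set
Follows k Js = ∀ w → Walk [ w , k ] Js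

stays-++ : ∀ {k w G Js} → Stays k w G → Follows k Js → Walk [ w , k ] (G ++ Js)
stays-++ {w = w} []            follows = follows w
stays-++         (v≤w ∷ stays) follows = stay v≤w ∷ stays-++ stays follows

jump-onto : ∀ {w k k′ Js} → k ≡ suc k′ → Walk [ k , k ] Js → Walk [ w , k′ ] ([ k , k ] ∷ Js)
jump-onto refl walk = jump ∷ walk

start-at : ∀ {k Js} → k ≡ 0 → Walk [ k , k ] Js → RWalk ([ k , k ] ∷ Js)
start-at refl = start

module _ (M : ℕ) where

  mirror-withLo-stays : ∀ {I Js} v → Walk I Js → Stays (M ∸ v) (M ∸ hi I) (map (mirror M) (withLo v Js))
  mirror-withLo-stays v [] = []
  mirror-withLo-stays v (_∷_ {J = J} I⇾J walk) with lo J ≡ᵇ v in J≡v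
  ... | true rewrite ≡ᵇ-true⁻¹ {lo J} J≡v = ∸-monoʳ-≤ M (⇾-hi I⇾J) ∷ mirror-withLo-stays v walk
  ... | false = stays-weaken (∸-monoʳ-≤ M (⇾-hi I⇾J)) (mirror-withLo-stays v walk)

  withLo-first : ∀ {I Js v} → Walk I Js → lo I ≤ hi I → hi I < v → v ≤ finalHi I Js →
                 ∃[ F ] withLo v Js ≡ [ v , v ] ∷ F × Stays (M ∸ v) (M ∸ v) (map (mirror M) F)
  withLo-first [] _ r<v v≤r = ⊥-elim (<⇒≱ r<v v≤r)
  withLo-first {v = v} (stay {v′ = v′} v′≤w ∷ walk) w≤r r<v v≤final
    rewrite ≡ᵇ-false {v′} {v} (λ v′≡v → <⇒≱ r<v (subst (_≤ _) v′≡v (≤-trans v′≤w w≤r))) =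
    withLo-first walk (≤-trans v′≤w w≤r) r<v v≤final
  withLo-first {v = v} (jump {r = r} ∷ walk) _ r<v v≤final with m≤n⇒m<n∨m≡n r<v
  ... | inj₂ refl rewrite ≡ᵇ-refl (suc r) = _ , refl , mirror-withLo-stays (suc r) walk
  ... | inj₁ 1+r<v rewrite ≡ᵇ-false {suc r} {v} (<⇒≢ 1+r<v) = withLo-first walk ≤-refl 1+r<v v≤final

module Panorama {Is} (walk : Walk [ 0 , 0 ] Is) where

  L : List Interval
  L = [ 0 , 0 ] ∷ Is

  M : ℕ
  M = finalHi [ 0 , 0 ] Is

  within : All (Within M) L
  within = (z≤n , z≤n) ∷ walk-Within walk z≤n

  -- The mirrored intervals of the entries of value v, in the order in which pan lists their views.
  block : ℕ → List Interval
  block v = map (mirror M) (withLo v L)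

  blocks : ℕ → List Interval
  blocks m = concatMap block (downFromIncl m)

  below : ℕ → List Interval
  below zero    = []
  below (suc m) = blocks m

  blocks≡ : ∀ m → blocks m ≡ block m ++ below m
  blocks≡ zero    = refl
  blocks≡ (suc m) = refl

  block-shape : ∀ {v} → v ≤ M → ∃[ G ] block v ≡ [ M ∸ v , M ∸ v ] ∷ G × Stays (M ∸ v) (M ∸ v) G
  block-shape {zero}  _     = _ , refl , mirror-withLo-stays M 0 walk
  block-shape {suc v} 1+v≤M with withLo-first M walk z≤n (s≤s z≤n) 1+v≤M
  ... | F , withLo≡ , stays = map (mirror M) F , cong (map (mirror M)) withLo≡ , stays

  block-walk : ∀ {m Js} → m ≤ M → Follows (M ∸ m) Js →
               ∃[ G ] block m ++ Js ≡ [ M ∸ m , M ∸ m ] ∷ G ++ Js × Walk [ M ∸ m , M ∸ m ] (G ++ Js)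
  block-walk {Js = Js} m≤M follows with block-shape m≤M
  ... | G , block≡ , stays = G , cong (_++ Js) block≡ , stays-++ stays follows

  below-follows : ∀ m → m ≤ M → Follows (M ∸ m) (below m)
  below-follows zero    _   _ = []
  below-follows (suc m) m<M w with block-walk (<⇒≤ m<M) (below-follows m (<⇒≤ m<M))
  ... | G , block++≡ , walk′ = subst (Walk [ w , M ∸ suc m ]) (sym (trans (blocks≡ m) block++≡))
                                     (jump-onto (m<n⇒n∸m≡1+[n∸1+m] m<M) walk′)

  blocks-rwalk : RWalk (blocks M)
  blocks-rwalk with block-walk ≤-refl (below-follows M ≤-refl)
  ... | G , block++≡ , walk′ = subst RWalk (sym (trans (blocks≡ M) block++≡)) (start-at (n∸n≡0 M) walk′)

  blocks-↭ : blocks M ↭ map (mirror M) L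
  blocks-↭ = ↭-trans (↭-reflexive (sym (map-concatMap (mirror M) (λ v → withLo v L) (downFromIncl M))))
                     (map⁺ (mirror M) (groups-↭ M L (All.map Within⇒lo≤ within)))

  pan-blocks : pan (map lo L) ≡ map lo (blocks M)
  pan-blocks = begin
    pan (map lo L)
      ≡⟨ cong₂ (λ ws m → concatMap (λ v → viewsWithValue v (map lo L) ws) (downFromIncl m)) views-L maxList-L ⟩
    concatMap (λ v → viewsWithValue v (map lo L) (map (λ J → M ∸ hi J) L)) (downFromIncl M)
      ≡⟨ concatMap-cong (λ v → viewsWithValue-map v L (λ J → M ∸ hi J)) (downFromIncl M) ⟩
    concatMap (λ v → map (λ J → M ∸ hi J) (withLo v L)) (downFromIncl M)
      ≡⟨ concatMap-cong (λ v → map-∘ (withLo v L)) (downFromIncl M) ⟩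
    concatMap (λ v → map lo (block v)) (downFromIncl M)
      ≡⟨ map-concatMap lo block (downFromIncl M) ⟨
    map lo (blocks M) ∎
    where
      open ≡-Reasoning
      views-L : views (map lo L) ≡ map (λ J → M ∸ hi J) L
      views-L = cong₂ _∷_ (viewAt-walk walk z≤n z≤n) (views-walk walk z≤n)
      maxList-L : maxList (map lo L) ≡ M
      maxList-L = trans (sym (⊔-identityʳ _)) (maxList-walk walk z≤n)

panorama-dual : ∀ {L} → RWalk L → IsAsc (pan (map lo L)) × (fAP (pan (map lo L)) ≅ dual (fAP (map lo L)))
panorama-dual rwalk@(start walk) rewrite Panorama.pan-blocks walk =
  rwalk-asc blocks-rwalk ,
  (begin
   fAP (map lo (blocks M))         ≐⟨ fAP-walk blocks-rwalk ⟩
   intervalOrder (blocks M)         ≅⟨ ↭⇒≅ blocks-↭ ⟩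
   intervalOrder (map (mirror M) L) ≐⟨ intervalOrder-mirror within ⟩
   dual (intervalOrder L)           ≐⟨ dual-cong (≐-sym (fAP-walk rwalk)) ⟩
   dual (fAP (map lo L))            ∎)
  where
    open Panorama walk
    open ≅-Reasoning

proposition4p8 : (a : List ℕ) → IsRAsc a → IsAsc (pan a) × (fAP (pan a) ≅ dual (fAP a))
proposition4p8 a rasc with rasc-walk rasc
... | L , rwalk , refl = panorama-dual rwalk
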